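{- Let $n\ge1$. There is a bijection $\varphi$ from the set $\mathcal{T}_n$ of plane trees with $n$ edges to the set $\mathcal{S}_n(132)$ of $132$-avoiding permutations of $\{1,\dots,n\}$ such that, for every $T\in\mathcal{T}_n$ with $\pi=\varphi(T)$: (1) the number of young leaves of $T$ equals the number of double ascents of $\pi(n+1)=(\pi_1,\dots,\pi_n,n+1)$; (2) the number of old leaves of $T$ equals the number of ascending runs of $\pi(n+1)$.
   Context: A plane tree is a rooted tree with the children of each vertex linearly ordered left to right; a leaf is a vertex with no children; a leaf is old if it is the leftmost child of its parent, young otherwise. A permutation $\pi$ avoids $132$ if there are no indices $a<b<c$ with $\pi_a<\pi_c<\pi_b$. For a sequence $\sigma=\sigma_1\cdots\sigma_m$ of distinct numbers, a double ascent is an index $i$ with $\sigma_i<\sigma_{i+1}<\sigma_{i+2}$, and an ascending run is a maximal increasing block of consecutive entries of length at least two, $\sigma_i<\sigma_{i+1}<\cdots<\sigma_{i+k}$ with $k\ge1$, not extendable to the left or right. -}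

module Defs where

open import Data.Nat using (ℕ; zero; suc; _+_; _<_; _<?_)
open import Data.Bool using (Bool; true; false; if_then_else_; _∧_; not)
open import Data.List using (List; []; _∷_; length; lookup; applyUpTo)
open import Data.List.Relation.Binary.Permutation.Propositional using (_↭_)
open import Data.Fin using (Fin)
import Data.Fin as F
open import Data.Product using (_×_)
open import Relation.Nullary using (¬_)
open import Relation.Nullary.Decidable using (⌊_⌋)

-- Plane trees: rooted trees whose children are linearly ordered
-- (left to right = order in the list).

data PTree : Set where
  node : List PTree → PTree

mutual
  edges : PTree → ℕ
  edges (node ts) = edgesL ts

  edgesL : List PTree → ℕ
  edgesL []       = 0
  edgesL (t ∷ ts) = suc (edges t + edgesL ts)

isLeaf : PTree → ℕ
isLeaf (node [])      = 1
isLeaf (node (_ ∷ _)) = 0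

countLeaves : List PTree → ℕ
countLeaves []       = 0
countLeaves (t ∷ ts) = isLeaf t + countLeaves ts

-- old leaves: leaves that are the leftmost child of their parent
mutual
  oldLeaves : PTree → ℕ
  oldLeaves (node [])       = 0
  oldLeaves (node (t ∷ ts)) = isLeaf t + oldLeavesL (t ∷ ts)

  oldLeavesL : List PTree → ℕ
  oldLeavesL []       = 0
  oldLeavesL (t ∷ ts) = oldLeaves t + oldLeavesL ts

-- young leaves: leaves that are not the leftmost child of their parent
mutual
  youngLeaves : PTree → ℕ
  youngLeaves (node [])       = 0
  youngLeaves (node (t ∷ ts)) = countLeaves ts + youngLeavesL (t ∷ ts)

  youngLeavesL : List PTree → ℕ
  youngLeavesL []       = 0
  youngLeavesL (t ∷ ts) = youngLeaves t + youngLeavesL ts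

-- Permutations of {1,…,n} as words (lists) π₁ ⋯ πₙ.

IsPerm : ℕ → List ℕ → Set
IsPerm n π = π ↭ applyUpTo suc n

Avoids132 : List ℕ → Set
Avoids132 π = (a b c : Fin (length π)) → a F.< b → b F.< c →
  ¬ (lookup π a < lookup π c × lookup π c < lookup π b)

doubleAscents : List ℕ → ℕ
doubleAscents (x ∷ y ∷ z ∷ r) =
  (if ⌊ x <? y ⌋ ∧ ⌊ y <? z ⌋ then 1 else 0) + doubleAscents (y ∷ z ∷ r)
doubleAscents _ = 0

-- number of ascending runs = number of indices i with σ_i < σ_{i+1}
-- such that i is the first index or σ_{i-1} > σ_i (start of a maximal run).
-- The flag records whether the previous adjacent pair was an ascent.
ascRunsFrom : Bool → List ℕ → ℕ
ascRunsFrom prev (x ∷ y ∷ r) =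
  (if ⌊ x <? y ⌋ ∧ not prev then 1 else 0) + ascRunsFrom ⌊ x <? y ⌋ (y ∷ r)
ascRunsFrom _ _ = 0

ascendingRuns : List ℕ → ℕ
ascendingRuns = ascRunsFrom false

-- Removing the last child t of the root of a plane tree T leaves a tree T′, and
-- φ T = join (φ T′) (φ t) = (φ T′ shifted above φ t) n (φ t) with n the number of edges.
-- Conversely every 132-avoiding permutation of 1‥n splits uniquely around its maximum n
-- as L n R with every entry of L larger than every entry of R, so φ is a bijection.
-- In the ascent word of φ(T)(n+1) the step from n into φ t is a descent, so the words of
-- T′ and t are glued by a single `false`; if t is a leaf, φ t is empty and the word just
-- gains a final `true`, which extends the last run by one double ascent (T′ ≠ leaf) or
-- opens a new run (T′ = leaf). Double ascents (adjacent `true`s) and ascending runs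
-- (maximal blocks of `true`s) thus obey the recursions of young and old leaves.

module Submission where

open import Defs
open import Data.Bool using (Bool; true; false; if_then_else_; _∧_; not)
open import Data.Bool.Properties using (∧-zeroʳ)
open import Data.Empty using (⊥-elim)
open import Data.Fin as Fin using (Fin)
open import Data.List using (List; []; _∷_; _++_; _∷ʳ_; [_]; map; length; lookup; applyUpTo; filter)
open import Data.List.Extrema.Nat using (max; xs≤max; argmax-all)
open import Data.List.Membership.Propositional using (_∈_)
open import Data.List.Membership.Propositional.Properties
  using (∈-applyUpTo⁺; ∈-applyUpTo⁻; ∈-lookup; ∈-++⁺ʳ; ∈-∃++)
open import Data.List.Properties
  using (++-assoc; ++-identityʳ; map-++; map-injective; length-++; length-map; applyUpTo-∷ʳ; map-applyUpTo;
         length-applyUpTo; filter-++; filter-all; filter-none; ∷-injective)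
open import Data.List.Relation.Binary.Permutation.Propositional
  using (_↭_; ↭-refl; ↭-sym; ↭⇒↭ₛ; module PermutationReasoning)
open import Data.List.Relation.Binary.Permutation.Propositional.Properties
  using (↭-length; ∈-resp-↭; map⁺; ++⁺; ++⁺ʳ; ++-comm; ∷↭∷ʳ; drop-mid; filter-↭)
open import Data.List.Relation.Binary.Permutation.Setoid.Properties using (Unique-resp-↭)
open import Data.List.Relation.Unary.All as All using (All; []; _∷_)
import Data.List.Relation.Unary.All.Properties as All
open import Data.List.Relation.Unary.AllPairs as AllPairs using (AllPairs; []; _∷_)
import Data.List.Relation.Unary.AllPairs.Properties as AllPairs
open import Data.List.Relation.Unary.Any using (here; there)
open import Data.List.Relation.Unary.Unique.Propositional using (Unique)
import Data.List.Relation.Unary.Unique.Propositional.Properties as Unique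
open import Data.List.Reverse using (reverseView; []; _∶_∶ʳ_)
open import Data.Nat using (ℕ; zero; suc; _+_; _∸_; _≤_; _<_; _<?_; _≤?_; z≤n; s≤s)
open import Data.Nat.Induction using (<-wellFounded)
open import Data.Nat.Properties
open import Data.Nat.Tactic.RingSolver using (solve-∀)
open import Data.Product using (Σ; ∃; ∃₂; _×_; _,_; proj₁; proj₂)
open import Function using (_∘_; id)
open import Induction.WellFounded using (Acc; acc)
open import Relation.Binary.PropositionalEquality hiding ([_])
open import Relation.Nullary using (¬_; Dec; yes; no)
open import Relation.Nullary.Decidable using (⌊_⌋; isYes≗does; dec-true; dec-false)

applyUpTo-cong : ∀ {A : Set} {f g : ℕ → A} → (∀ i → f i ≡ g i) → ∀ n → applyUpTo f n ≡ applyUpTo g n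
applyUpTo-cong f≗g zero    = refl
applyUpTo-cong f≗g (suc n) = cong₂ _∷_ (f≗g 0) (applyUpTo-cong (f≗g ∘ suc) n)

applyUpTo-++ : ∀ {A : Set} (f : ℕ → A) m n → applyUpTo f (m + n) ≡ applyUpTo f m ++ applyUpTo (λ i → f (m + i)) n
applyUpTo-++ f zero    n = refl
applyUpTo-++ f (suc m) n = cong (f 0 ∷_) (applyUpTo-++ (f ∘ suc) m n)

map-+-∸ : ∀ k xs → All (k ≤_) xs → map (_+ k) (map (_∸ k) xs) ≡ xs
map-+-∸ k []       []           = refl
map-+-∸ k (x ∷ xs) (k≤x ∷ k≤xs) = cong₂ _∷_ (m∸n+n≡m k≤x) (map-+-∸ k xs k≤xs)

++-∷-injective : ∀ {A : Set} {M : A} L L′ {R R′} → All (M ≢_) L → All (M ≢_) L′ →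
  L ++ M ∷ R ≡ L′ ++ M ∷ R′ → L ≡ L′ × R ≡ R′
++-∷-injective []      []        _         _           eq = refl , proj₂ (∷-injective eq)
++-∷-injective []      (x′ ∷ L′) _         (M≢x′ ∷ _)  eq = ⊥-elim (M≢x′ (proj₁ (∷-injective eq)))
++-∷-injective (x ∷ L) []        (M≢x ∷ _) _           eq = ⊥-elim (M≢x (sym (proj₁ (∷-injective eq))))
++-∷-injective (x ∷ L) (x′ ∷ L′) (_ ∷ M≢L) (_ ∷ M≢L′)  eq
  with refl , eq′  ← ∷-injective eq
  with refl , refl ← ++-∷-injective L L′ M≢L M≢L′ eq′ = refl , refl

allPairs-lookup : ∀ {A : Set} {R : A → A → Set} {xs} → AllPairs R xs →
  ∀ {i j : Fin (length xs)} → i Fin.< j → R (lookup xs i) (lookup xs j)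
allPairs-lookup (Rx ∷ _)  {Fin.zero}  {Fin.suc j} _         = All.lookup Rx (∈-lookup j)
allPairs-lookup (_ ∷ Rxs) {Fin.suc i} {Fin.suc j} (s≤s i<j) = allPairs-lookup Rxs i<j

all-tabulate-lookup : ∀ {A : Set} {P : A → Set} xs → (∀ i → P (lookup xs i)) → All P xs
all-tabulate-lookup []       P-lookup = []
all-tabulate-lookup (x ∷ xs) P-lookup = P-lookup Fin.zero ∷ all-tabulate-lookup xs (P-lookup ∘ Fin.suc)

allPairs-tabulate-lookup : ∀ {A : Set} {R : A → A → Set} xs →
  (∀ {i j : Fin (length xs)} → i Fin.< j → R (lookup xs i) (lookup xs j)) → AllPairs R xs
allPairs-tabulate-lookup []       R-lookup = []
allPairs-tabulate-lookup (x ∷ xs) R-lookup =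
  all-tabulate-lookup xs (λ j → R-lookup {Fin.zero} {Fin.suc j} (s≤s z≤n))
  ∷ allPairs-tabulate-lookup xs (λ i<j → R-lookup (s≤s i<j))

allPairs-++⁻ˡ : ∀ {A : Set} {R : A → A → Set} xs {ys} → AllPairs R (xs ++ ys) → AllPairs R xs
allPairs-++⁻ˡ []       _          = []
allPairs-++⁻ˡ (x ∷ xs) (Rx ∷ Rxs) = All.++⁻ˡ xs Rx ∷ allPairs-++⁻ˡ xs Rxs

allPairs-++⁻ʳ : ∀ {A : Set} {R : A → A → Set} xs {ys} → AllPairs R (xs ++ ys) → AllPairs R ys
allPairs-++⁻ʳ []       Rys       = Rys
allPairs-++⁻ʳ (x ∷ xs) (_ ∷ Rxs) = allPairs-++⁻ʳ xs Rxs

allPairs-across : ∀ {A : Set} {R : A → A → Set} xs {ys} → AllPairs R (xs ++ ys) →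
  ∀ {x y} → x ∈ xs → y ∈ ys → R x y
allPairs-across (x ∷ xs) (Rx ∷ _)  (here refl) y∈ = All.lookup (All.++⁻ʳ xs Rx) y∈
allPairs-across (x ∷ xs) (_ ∷ Rxs) (there x∈)  y∈ = allPairs-across xs Rxs x∈ y∈

allPairs-fromAllʳ : ∀ {A : Set} {P : A → Set} {xs} → All P xs → AllPairs (λ _ z → P z) xs
allPairs-fromAllʳ []       = []
allPairs-fromAllʳ (_ ∷ ps) = ps ∷ allPairs-fromAllʳ ps

-- interval 0 n is definitionally applyUpTo suc n, the list 1‥n of IsPerm n.
interval : ℕ → ℕ → List ℕ
interval k n = applyUpTo (λ i → suc (k + i)) n

interval-++ : ∀ k m n → interval k (m + n) ≡ interval k m ++ interval (k + m) n
interval-++ k m n = trans (applyUpTo-++ _ m n)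
  (cong (interval k m ++_) (applyUpTo-cong (λ i → cong suc (sym (+-assoc k m i))) n))

interval-∷ʳ : ∀ n → interval 0 n ∷ʳ suc n ≡ interval 0 (suc n)
interval-∷ʳ = applyUpTo-∷ʳ suc

map-+-interval : ∀ e k n → map (_+ e) (interval k n) ≡ interval (k + e) n
map-+-interval e k n = trans (map-applyUpTo _ (_+ e) n) (applyUpTo-cong shift n)
  where
  shift : ∀ i → suc (k + i) + e ≡ suc (k + e + i)
  shift i = cong suc (trans (+-assoc k i e) (trans (cong (k +_) (+-comm i e)) (sym (+-assoc k e i))))

map-∸-interval : ∀ k n → map (_∸ k) (interval k n) ≡ interval 0 n
map-∸-interval k n = trans (map-applyUpTo _ (_∸ k) n)
  (applyUpTo-cong (λ i → trans (cong (_∸ k) (sym (+-suc k i))) (m+n∸m≡n k (suc i))) n)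

∈-interval : ∀ {x} k n → x ∈ interval k n → k < x × x ≤ k + n
∈-interval k n x∈ with ∈-applyUpTo⁻ _ x∈
... | i , i<n , refl = s≤s (m≤m+n k i) , +-monoʳ-< k i<n

filter-≤-interval : ∀ k n → filter (_≤? k) (interval 0 (k + n)) ≡ interval 0 k
filter-≤-interval k n = begin
  filter (_≤? k) (interval 0 (k + n))                          ≡⟨ cong (filter (_≤? k)) (interval-++ 0 k n) ⟩
  filter (_≤? k) (interval 0 k ++ interval k n)               ≡⟨ filter-++ (_≤? k) (interval 0 k) _ ⟩
  filter (_≤? k) (interval 0 k) ++ filter (_≤? k) (interval k n)
    ≡⟨ cong₂ _++_ (filter-all (_≤? k) (All.tabulate (proj₂ ∘ ∈-interval 0 k)))
                  (filter-none (_≤? k) (All.tabulate (<⇒≱ ∘ proj₁ ∘ ∈-interval k n))) ⟩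
  interval 0 k ++ []                                           ≡⟨ ++-identityʳ _ ⟩
  interval 0 k                                                 ∎
  where open ≡-Reasoning

filter->-interval : ∀ k n → filter (k <?_) (interval 0 (k + n)) ≡ interval k n
filter->-interval k n = begin
  filter (k <?_) (interval 0 (k + n))                          ≡⟨ cong (filter (k <?_)) (interval-++ 0 k n) ⟩
  filter (k <?_) (interval 0 k ++ interval k n)               ≡⟨ filter-++ (k <?_) (interval 0 k) _ ⟩
  filter (k <?_) (interval 0 k) ++ filter (k <?_) (interval k n)
    ≡⟨ cong₂ _++_ (filter-none (k <?_) (All.tabulate (≤⇒≯ ∘ proj₂ ∘ ∈-interval 0 k)))
                  (filter-all (k <?_) (All.tabulate (proj₁ ∘ ∈-interval k n))) ⟩
  interval k n                                                 ∎
  where open ≡-Reasoning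

IsPermutation : List ℕ → Set
IsPermutation σ = IsPerm (length σ) σ

isPerm-bounded : ∀ {n π} → IsPerm n π → All (λ x → 0 < x × x ≤ n) π
isPerm-bounded {n} π↭ = All.tabulate (∈-interval 0 n ∘ ∈-resp-↭ π↭)

isPerm-length : ∀ {n π} → IsPerm n π → length π ≡ n
isPerm-length {n} π↭ = trans (↭-length π↭) (length-applyUpTo suc n)

isPerm-unique : ∀ {n π} → IsPerm n π → Unique π
isPerm-unique {n} π↭ =
  Unique-resp-↭ (setoid ℕ) (↭⇒↭ₛ (↭-sym π↭)) (Unique.applyUpTo⁺₁ suc n (λ i<j _ → <⇒≢ (s≤s i<j)))

-- 132-avoidance

Is132 : ℕ → ℕ → ℕ → Set
Is132 x y z = x < z × z < y

-- Avoids132 by recursion on the word: no entry x is the 1 of an occurrence x y z of 132.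
data Avoids132ᴸ : List ℕ → Set where
  []  : Avoids132ᴸ []
  _∷_ : ∀ {x xs} → AllPairs (λ y z → ¬ Is132 x y z) xs → Avoids132ᴸ xs → Avoids132ᴸ (x ∷ xs)

avoids132ᴸ⇒avoids132 : ∀ {π} → Avoids132ᴸ π → Avoids132 π
avoids132ᴸ⇒avoids132 (h ∷ _)  Fin.zero    (Fin.suc b) (Fin.suc c) _         (s≤s b<c) = allPairs-lookup h b<c
avoids132ᴸ⇒avoids132 (_ ∷ av) (Fin.suc a) (Fin.suc b) (Fin.suc c) (s≤s a<b) (s≤s b<c) =
  avoids132ᴸ⇒avoids132 av a b c a<b b<c

avoids132⇒avoids132ᴸ : ∀ π → Avoids132 π → Avoids132ᴸ π
avoids132⇒avoids132ᴸ []       _  = []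
avoids132⇒avoids132ᴸ (x ∷ xs) av =
  allPairs-tabulate-lookup xs (λ {b} {c} b<c → av Fin.zero (Fin.suc b) (Fin.suc c) (s≤s z≤n) (s≤s b<c))
  ∷ avoids132⇒avoids132ᴸ xs (λ a b c a<b b<c → av (Fin.suc a) (Fin.suc b) (Fin.suc c) (s≤s a<b) (s≤s b<c))

avoids132ᴸ-map⁺ : ∀ {f : ℕ → ℕ} → (∀ {x y} → f x < f y → x < y) →
  ∀ {xs} → Avoids132ᴸ xs → Avoids132ᴸ (map f xs)
avoids132ᴸ-map⁺ reflects []       = []
avoids132ᴸ-map⁺ reflects (h ∷ av) =
  AllPairs.map⁺ (AllPairs.map (λ ¬132 (fx<fz , fz<fy) → ¬132 (reflects fx<fz , reflects fz<fy)) h)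
  ∷ avoids132ᴸ-map⁺ reflects av

avoids132ᴸ-map⁻ : ∀ {f : ℕ → ℕ} → (∀ {x y} → x < y → f x < f y) →
  ∀ xs → Avoids132ᴸ (map f xs) → Avoids132ᴸ xs
avoids132ᴸ-map⁻ preserves []       []       = []
avoids132ᴸ-map⁻ preserves (x ∷ xs) (h ∷ av) =
  AllPairs.map (λ ¬132 (x<z , z<y) → ¬132 (preserves x<z , preserves z<y)) (AllPairs.map⁻ h)
  ∷ avoids132ᴸ-map⁻ preserves xs av

avoids132ᴸ-++⁺ : ∀ {xs ys} → Avoids132ᴸ xs → Avoids132ᴸ ys →
  All (λ x → All (_< x) ys) xs → Avoids132ᴸ (xs ++ ys)
avoids132ᴸ-++⁺ []       av-ys _              = av-ys
avoids132ᴸ-++⁺ (h ∷ av) av-ys (ys<x ∷ ys<xs) =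
  AllPairs.++⁺ h (AllPairs.map ¬132-at (allPairs-fromAllʳ ys<x))
                 (All.tabulate (λ _ → All.map ¬132-at ys<x))
  ∷ avoids132ᴸ-++⁺ av av-ys ys<xs
  where
  ¬132-at : ∀ {x y z} → z < x → ¬ Is132 x y z
  ¬132-at z<x (x<z , _) = <-asym z<x x<z

avoids132ᴸ-∷ʳ : ∀ {xs M} → Avoids132ᴸ xs → All (_< M) xs → Avoids132ᴸ (xs ∷ʳ M)
avoids132ᴸ-∷ʳ []       []           = [] ∷ []
avoids132ᴸ-∷ʳ (h ∷ av) (_ ∷ xs<M) =
  AllPairs.++⁺ h ([] ∷ []) (All.map (λ y<M → (λ (_ , M<y) → <-asym y<M M<y) ∷ []) xs<M)
  ∷ avoids132ᴸ-∷ʳ av xs<M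

avoids132ᴸ-++⁻ : ∀ xs {ys} → Avoids132ᴸ (xs ++ ys) → Avoids132ᴸ xs × Avoids132ᴸ ys
avoids132ᴸ-++⁻ []       av       = [] , av
avoids132ᴸ-++⁻ (x ∷ xs) (h ∷ av) with avoids132ᴸ-++⁻ xs av
... | av-xs , av-ys = allPairs-++⁻ˡ xs h ∷ av-xs , av-ys

avoids132ᴸ-across : ∀ L {M R} → Avoids132ᴸ (L ++ M ∷ R) → ∀ {l r} → l ∈ L → r ∈ R → ¬ Is132 l M r
avoids132ᴸ-across (x ∷ L) (h ∷ _)  (here refl) r∈ = All.lookup (AllPairs.head (allPairs-++⁻ʳ L h)) r∈
avoids132ᴸ-across (x ∷ L) (_ ∷ av) (there l∈)  r∈ = avoids132ᴸ-across L av l∈ r∈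

-- Splitting a 132-avoiding permutation at its maximum

join : List ℕ → List ℕ → List ℕ
join A B = map (_+ length B) A ++ suc (length A + length B) ∷ B

length-join : ∀ A B → length (join A B) ≡ suc (length A + length B)
length-join A B =
  trans (length-++ (map (_+ length B) A)) (trans (+-suc _ _) (cong (λ a → suc (a + length B)) (length-map _ A)))

join-longer : ∀ A B → length A < length (join A B) × length B < length (join A B)
join-longer A B = subst (length A <_) (sym (length-join A B)) (s≤s (m≤m+n _ _))
                , subst (length B <_) (sym (length-join A B)) (s≤s (m≤n+m _ _))

join-≢[] : ∀ A B → join A B ≢ []
join-≢[] A B join≡[] with () ← trans (sym (length-join A B)) (cong length join≡[])

shifted-below-max : ∀ {A} b → IsPermutation A → All (_< suc (length A + b)) (map (_+ b) A)
shifted-below-max b A↭ = All.map⁺ (All.map (λ (_ , x≤a) → s≤s (+-monoˡ-≤ b x≤a)) (isPerm-bounded A↭))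

join-isPermutation : ∀ {A B} → IsPermutation A → IsPermutation B → IsPermutation (join A B)
join-isPermutation {A} {B} A↭ B↭ = begin
  map (_+ b) A ++ M ∷ B                  ↭⟨ ++-comm (map (_+ b) A) (M ∷ B) ⟩
  M ∷ B ++ map (_+ b) A                  ↭⟨ ∷↭∷ʳ M (B ++ map (_+ b) A) ⟩
  (B ++ map (_+ b) A) ∷ʳ M               ↭⟨ ++⁺ʳ [ M ] (++⁺ B↭ (map⁺ (_+ b) A↭)) ⟩
  (interval 0 b ++ map (_+ b) (interval 0 a)) ∷ʳ M
    ≡⟨ cong (λ xs → (interval 0 b ++ xs) ∷ʳ M) (map-+-interval b 0 a) ⟩
  (interval 0 b ++ interval b a) ∷ʳ M    ≡⟨ cong (_∷ʳ M) (interval-++ 0 b a) ⟨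
  interval 0 (b + a) ∷ʳ M                ≡⟨ cong (λ m → interval 0 m ∷ʳ M) (+-comm b a) ⟩
  interval 0 (a + b) ∷ʳ M                ≡⟨ interval-∷ʳ (a + b) ⟩
  interval 0 (suc (a + b))               ≡⟨ cong (interval 0) (length-join A B) ⟨
  interval 0 (length (join A B))         ∎
  where
  open PermutationReasoning
  a b M : ℕ
  a = length A
  b = length B
  M = suc (a + b)

join-avoids132ᴸ : ∀ {A B} → IsPermutation A → IsPermutation B →
  Avoids132ᴸ A → Avoids132ᴸ B → Avoids132ᴸ (join A B)
join-avoids132ᴸ {A} {B} A↭ B↭ avA avB =
  subst Avoids132ᴸ (++-assoc (map (_+ b) A) [ M ] B)
    (avoids132ᴸ-++⁺ (avoids132ᴸ-∷ʳ (avoids132ᴸ-map⁺ (λ {x} {y} → +-cancelʳ-< b x y) avA)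
                                   (shifted-below-max b A↭))
                    avB
                    (All.++⁺ (All.map⁺ (All.map B<x+b (isPerm-bounded A↭))) (B<M ∷ [])))
  where
  a b M : ℕ
  a = length A
  b = length B
  M = suc (a + b)
  B<x+b : ∀ {x} → 0 < x × x ≤ a → All (_< x + b) B
  B<x+b (0<x , _) = All.map (λ (_ , y≤b) → ≤-trans (s≤s y≤b) (+-monoˡ-≤ b 0<x)) (isPerm-bounded B↭)
  B<M : All (_< M) B
  B<M = All.map (λ (_ , y≤b) → s≤s (≤-trans y≤b (m≤n+m b a))) (isPerm-bounded B↭)

join-injective : ∀ {A B A′ B′} → IsPermutation A → IsPermutation A′ →
  join A B ≡ join A′ B′ → A ≡ A′ × B ≡ B′
join-injective {A} {B} {A′} {B′} A↭ A′↭ eq =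
  unshift (++-∷-injective (map (_+ length B) A) (map (_+ length B′) A′)
    (All.map (≢-sym ∘ <⇒≢) (shifted-below-max (length B) A↭))
    (All.map (λ {x} x<M′ → ≢-sym (<⇒≢ (subst (x <_) (sym same-M) x<M′))) (shifted-below-max (length B′) A′↭))
    (trans eq (cong (λ m → map (_+ length B′) A′ ++ m ∷ B′) (sym same-M))))
  where
  same-M : suc (length A + length B) ≡ suc (length A′ + length B′)
  same-M = trans (sym (length-join A B)) (trans (cong length eq) (length-join A′ B′))
  unshift : map (_+ length B) A ≡ map (_+ length B′) A′ × B ≡ B′ → A ≡ A′ × B ≡ B′
  unshift (shifted-A≡ , refl) = map-injective (λ {x} {y} → +-cancelʳ-≡ (length B) x y) shifted-A≡ , refl

separated-by-max : ∀ {m} L R → IsPerm (suc m) (L ++ suc m ∷ R) → Avoids132ᴸ (L ++ suc m ∷ R) →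
  ∀ {l r} → l ∈ L → r ∈ R → r < l
separated-by-max {m} L R π↭ av {l} {r} l∈ r∈ = ≤∧≢⇒< r≤l (≢-sym l≢r)
  where
  r<M : r < suc m
  r<M = ≤∧≢⇒< (proj₂ (All.lookup (isPerm-bounded π↭) (∈-++⁺ʳ L (there r∈))))
              (≢-sym (All.lookup (AllPairs.head (allPairs-++⁻ʳ L (isPerm-unique π↭))) r∈))
  r≤l : r ≤ l
  r≤l = ≮⇒≥ (λ l<r → avoids132ᴸ-across L av l∈ r∈ (l<r , r<M))
  l≢r : l ≢ r
  l≢r = allPairs-across L (isPerm-unique π↭) l∈ (there r∈)

separated-isPerm : ∀ {m} L R → IsPerm m (L ++ R) → (∀ {l r} → l ∈ L → r ∈ R → r < l) →
  L ↭ interval (length R) (length L) × IsPermutation R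
separated-isPerm {m} L R LR↭ R<L =
  subst₂ (λ k n → L ↭ interval k n)
         (sym (isPerm-length R↭)) (trans (sym (length-applyUpTo _ _)) (sym (↭-length L↭))) L↭
  , subst (λ k → IsPerm k R) (sym (isPerm-length R↭)) R↭
  where
  bounds : All (λ x → 0 < x × x ≤ m) (L ++ R)
  bounds = isPerm-bounded LR↭
  -- L and R fill 1‥m with R below L, so they are k+1‥m and 1‥k for k = max R.
  k : ℕ
  k = max 0 R
  R≤k : All (_≤ k) R
  R≤k = xs≤max 0 R
  k<L : All (k <_) L
  k<L = All.tabulate λ l∈ → argmax-all id (proj₁ (All.lookup (All.++⁻ˡ L bounds) l∈)) (All.tabulate (R<L l∈))
  k≤m : k ≤ m
  k≤m = argmax-all id z≤n (All.map proj₂ (All.++⁻ʳ L bounds))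
  m≡k+[m∸k] : m ≡ k + (m ∸ k)
  m≡k+[m∸k] = sym (m+[n∸m]≡n k≤m)
  R↭ : R ↭ interval 0 k
  R↭ = begin
    R                                  ≡⟨ cong₂ _++_ (filter-none (_≤? k) (All.map <⇒≱ k<L)) (filter-all (_≤? k) R≤k) ⟨
    filter (_≤? k) L ++ filter (_≤? k) R ≡⟨ filter-++ (_≤? k) L R ⟨
    filter (_≤? k) (L ++ R)            ↭⟨ filter-↭ (_≤? k) LR↭ ⟩
    filter (_≤? k) (interval 0 m)      ≡⟨ cong (filter (_≤? k) ∘ interval 0) m≡k+[m∸k] ⟩
    filter (_≤? k) (interval 0 (k + (m ∸ k))) ≡⟨ filter-≤-interval k (m ∸ k) ⟩
    interval 0 k                       ∎
    where open PermutationReasoning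
  L↭ : L ↭ interval k (m ∸ k)
  L↭ = begin
    L                                  ≡⟨ ++-identityʳ L ⟨
    L ++ []                            ≡⟨ cong₂ _++_ (filter-all (k <?_) k<L) (filter-none (k <?_) (All.map ≤⇒≯ R≤k)) ⟨
    filter (k <?_) L ++ filter (k <?_) R ≡⟨ filter-++ (k <?_) L R ⟨
    filter (k <?_) (L ++ R)            ↭⟨ filter-↭ (k <?_) LR↭ ⟩
    filter (k <?_) (interval 0 m)      ≡⟨ cong (filter (k <?_) ∘ interval 0) m≡k+[m∸k] ⟩
    filter (k <?_) (interval 0 (k + (m ∸ k))) ≡⟨ filter->-interval k (m ∸ k) ⟩
    interval k (m ∸ k)                 ∎
    where open PermutationReasoning

join-surjective : ∀ {m} π → IsPerm (suc m) π → Avoids132ᴸ π →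
  ∃₂ λ A B → IsPermutation A × Avoids132ᴸ A × IsPermutation B × Avoids132ᴸ B × join A B ≡ π
join-surjective {m} π π↭ av with L , R , refl ← ∈-∃++ (∈-resp-↭ (↭-sym π↭) (∈-applyUpTo⁺ suc (n<1+n m)))
  = A , R , A↭ , avoids132ᴸ-map⁻ (+-monoˡ-< k) A (subst Avoids132ᴸ (sym unshift) avL) , R↭ , avR , join≡
  where
  LR↭ : IsPerm m (L ++ R)
  LR↭ = subst (L ++ R ↭_) (++-identityʳ _)
          (drop-mid L (interval 0 m) (subst (L ++ suc m ∷ R ↭_) (sym (interval-∷ʳ m)) π↭))
  separated : L ↭ interval (length R) (length L) × IsPermutation R
  separated = separated-isPerm L R LR↭ (separated-by-max L R π↭ av)
  L↭ : L ↭ interval (length R) (length L)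
  L↭ = proj₁ separated
  R↭ : IsPermutation R
  R↭ = proj₂ separated
  k : ℕ
  k = length R
  A : List ℕ
  A = map (_∸ k) L
  unshift : map (_+ k) A ≡ L
  unshift = map-+-∸ k L (All.tabulate (<⇒≤ ∘ proj₁ ∘ ∈-interval k (length L) ∘ ∈-resp-↭ L↭))
  A↭ : IsPermutation A
  A↭ = subst (λ n → A ↭ interval 0 n) (sym (length-map (_∸ k) L))
         (subst (A ↭_) (map-∸-interval k (length L)) (map⁺ (_∸ k) L↭))
  avL : Avoids132ᴸ L
  avL = proj₁ (avoids132ᴸ-++⁻ L av)
  avR : Avoids132ᴸ R
  avR with _ ∷ avR ← proj₂ (avoids132ᴸ-++⁻ L av) = avR
  join≡ : join A R ≡ L ++ suc m ∷ R
  join≡ = cong₂ (λ X n → X ++ suc n ∷ R) unshift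
    (trans (cong (_+ k) (length-map (_∸ k) L)) (trans (sym (length-++ L)) (isPerm-length LR↭)))

-- Ascent words

⌊<?⌋-true : ∀ {x y} → x < y → ⌊ x <? y ⌋ ≡ true
⌊<?⌋-true x<y = trans (isYes≗does (_ <? _)) (dec-true (_ <? _) x<y)

⌊<?⌋-false : ∀ {x y} → ¬ x < y → ⌊ x <? y ⌋ ≡ false
⌊<?⌋-false x≮y = trans (isYes≗does (_ <? _)) (dec-false (_ <? _) x≮y)

ascentWord : List ℕ → List Bool
ascentWord (x ∷ y ∷ r) = ⌊ x <? y ⌋ ∷ ascentWord (y ∷ r)
ascentWord _           = []

adjacentTrues : List Bool → ℕ
adjacentTrues (p ∷ q ∷ r) = (if p ∧ q then 1 else 0) + adjacentTrues (q ∷ r)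
adjacentTrues _           = 0

trueRuns : Bool → List Bool → ℕ
trueRuns p []       = 0
trueRuns p (q ∷ qs) = (if q ∧ not p then 1 else 0) + trueRuns q qs

doubleAscents-ascentWord : ∀ σ → doubleAscents σ ≡ adjacentTrues (ascentWord σ)
doubleAscents-ascentWord []              = refl
doubleAscents-ascentWord (x ∷ [])        = refl
doubleAscents-ascentWord (x ∷ y ∷ [])    = refl
doubleAscents-ascentWord (x ∷ y ∷ z ∷ r) = cong (_ +_) (doubleAscents-ascentWord (y ∷ z ∷ r))

ascRunsFrom-ascentWord : ∀ p σ → ascRunsFrom p σ ≡ trueRuns p (ascentWord σ)
ascRunsFrom-ascentWord p []          = refl
ascRunsFrom-ascentWord p (x ∷ [])    = refl
ascRunsFrom-ascentWord p (x ∷ y ∷ r) = cong (_ +_) (ascRunsFrom-ascentWord _ (y ∷ r))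

adjacentTrues-++-false : ∀ u v → adjacentTrues (u ++ false ∷ v) ≡ adjacentTrues u + adjacentTrues v
adjacentTrues-++-false []          []      = refl
adjacentTrues-++-false []          (_ ∷ _) = refl
adjacentTrues-++-false (p ∷ [])    v =
  cong₂ _+_ (cong (λ q → if q then 1 else 0) (∧-zeroʳ p)) (adjacentTrues-++-false [] v)
adjacentTrues-++-false (p ∷ q ∷ u) v =
  trans (cong (_ +_) (adjacentTrues-++-false (q ∷ u) v)) (sym (+-assoc (if p ∧ q then 1 else 0) _ _))

trueRuns-++-false : ∀ p u v → trueRuns p (u ++ false ∷ v) ≡ trueRuns p u + trueRuns false v
trueRuns-++-false p []      v = refl
trueRuns-++-false p (q ∷ u) v =
  trans (cong (_ +_) (trueRuns-++-false q u v)) (sym (+-assoc (if q ∧ not p then 1 else 0) _ _))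

adjacentTrues-∷ʳ-true : ∀ u → adjacentTrues (u ∷ʳ true ∷ʳ true) ≡ adjacentTrues (u ∷ʳ true) + 1
adjacentTrues-∷ʳ-true []          = refl
adjacentTrues-∷ʳ-true (p ∷ [])    = cong (_+ 1) (sym (+-identityʳ (if p ∧ true then 1 else 0)))
adjacentTrues-∷ʳ-true (p ∷ q ∷ u) =
  trans (cong (_ +_) (adjacentTrues-∷ʳ-true (q ∷ u))) (sym (+-assoc (if p ∧ q then 1 else 0) _ 1))

trueRuns-∷ʳ-true : ∀ p u → trueRuns p (u ∷ʳ true ∷ʳ true) ≡ trueRuns p (u ∷ʳ true)
trueRuns-∷ʳ-true p []      = refl
trueRuns-∷ʳ-true p (q ∷ u) = cong (_ +_) (trueRuns-∷ʳ-true q u)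

ascentWord-++ : ∀ xs y ys → ascentWord (xs ++ y ∷ ys) ≡ ascentWord (xs ∷ʳ y) ++ ascentWord (y ∷ ys)
ascentWord-++ []           y ys = refl
ascentWord-++ (x ∷ [])     y ys = refl
ascentWord-++ (x ∷ x′ ∷ xs) y ys = cong (_ ∷_) (ascentWord-++ (x′ ∷ xs) y ys)

ascentWord-map : ∀ {f : ℕ → ℕ} → (∀ {x y} → x < y → f x < f y) → (∀ {x y} → f x < f y → x < y) →
  ∀ xs → ascentWord (map f xs) ≡ ascentWord xs
ascentWord-map preserves reflects []          = refl
ascentWord-map preserves reflects (x ∷ [])    = refl
ascentWord-map {f} preserves reflects (x ∷ y ∷ r) =
  cong₂ _∷_ (ascent-map (x <? y)) (ascentWord-map preserves reflects (y ∷ r))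
  where
  ascent-map : Dec (x < y) → ⌊ f x <? f y ⌋ ≡ ⌊ x <? y ⌋
  ascent-map (yes x<y) = trans (⌊<?⌋-true (preserves x<y)) (sym (⌊<?⌋-true x<y))
  ascent-map (no x≮y)  = trans (⌊<?⌋-false (x≮y ∘ reflects)) (sym (⌊<?⌋-false x≮y))

ascentWord-∷ʳ-cong : ∀ {x y} xs → All (_< x) xs → All (_< y) xs → ascentWord (xs ∷ʳ x) ≡ ascentWord (xs ∷ʳ y)
ascentWord-∷ʳ-cong []           _             _             = refl
ascentWord-∷ʳ-cong (z ∷ [])     (z<x ∷ _)     (z<y ∷ _)     =
  cong [_] (trans (⌊<?⌋-true z<x) (sym (⌊<?⌋-true z<y)))
ascentWord-∷ʳ-cong (z ∷ z′ ∷ zs) (_ ∷ zs<x)   (_ ∷ zs<y)    = cong (_ ∷_) (ascentWord-∷ʳ-cong (z′ ∷ zs) zs<x zs<y)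

ascentWord-∷ʳ-max : ∀ x xs {N} → All (_< N) (x ∷ xs) → ascentWord (x ∷ xs ∷ʳ N) ≡ ascentWord (x ∷ xs) ∷ʳ true
ascentWord-∷ʳ-max x []        (x<N ∷ _)  = cong [_] (⌊<?⌋-true x<N)
ascentWord-∷ʳ-max x (x′ ∷ xs) (_ ∷ xs<N) = cong (_ ∷_) (ascentWord-∷ʳ-max x′ xs xs<N)

cappedAscentWord : List ℕ → List Bool
cappedAscentWord σ = ascentWord (σ ∷ʳ suc (length σ))

cappedAscentWord-shift : ∀ b A → ascentWord (map (_+ b) A ∷ʳ suc (length A + b)) ≡ cappedAscentWord A
cappedAscentWord-shift b A =
  trans (cong ascentWord (sym (map-++ (_+ b) A [ suc (length A) ])))
        (ascentWord-map (+-monoˡ-< b) (λ {x} {y} → +-cancelʳ-< b x y) (A ∷ʳ suc (length A)))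

cappedAscentWord-join-[] : ∀ A → cappedAscentWord (join A []) ≡ cappedAscentWord A ∷ʳ true
cappedAscentWord-join-[] A = begin
  ascentWord ((map (_+ 0) A ∷ʳ M) ∷ʳ suc (length (join A [])))
    ≡⟨ cong (λ n → ascentWord ((map (_+ 0) A ∷ʳ M) ∷ʳ suc n)) (length-join A []) ⟩
  ascentWord ((map (_+ 0) A ∷ʳ M) ∷ʳ suc M)      ≡⟨ cong ascentWord (++-assoc (map (_+ 0) A) [ M ] [ suc M ]) ⟩
  ascentWord (map (_+ 0) A ++ M ∷ [ suc M ])      ≡⟨ ascentWord-++ (map (_+ 0) A) M [ suc M ] ⟩
  ascentWord (map (_+ 0) A ∷ʳ M) ∷ʳ ⌊ M <? suc M ⌋ ≡⟨ cong₂ _∷ʳ_ (cappedAscentWord-shift 0 A) (⌊<?⌋-true (n<1+n M)) ⟩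
  cappedAscentWord A ∷ʳ true                      ∎
  where
  open ≡-Reasoning
  M : ℕ
  M = suc (length A + 0)

cappedAscentWord-join-∷ : ∀ A y B → All (_≤ length (y ∷ B)) (y ∷ B) →
  cappedAscentWord (join A (y ∷ B)) ≡ cappedAscentWord A ++ false ∷ cappedAscentWord (y ∷ B)
cappedAscentWord-join-∷ A y B ≤b = begin
  ascentWord ((map (_+ b) A ++ M ∷ y ∷ B) ∷ʳ suc (length (join A (y ∷ B))))
    ≡⟨ cong (λ n → ascentWord ((map (_+ b) A ++ M ∷ y ∷ B) ∷ʳ suc n)) (length-join A (y ∷ B)) ⟩
  ascentWord ((map (_+ b) A ++ M ∷ y ∷ B) ∷ʳ suc M) ≡⟨ cong ascentWord (++-assoc (map (_+ b) A) (M ∷ y ∷ B) [ suc M ]) ⟩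
  ascentWord (map (_+ b) A ++ M ∷ (y ∷ B ∷ʳ suc M)) ≡⟨ ascentWord-++ (map (_+ b) A) M (y ∷ B ∷ʳ suc M) ⟩
  ascentWord (map (_+ b) A ∷ʳ M) ++ ⌊ M <? y ⌋ ∷ ascentWord (y ∷ B ∷ʳ suc M)
    ≡⟨ cong₂ _++_ (cappedAscentWord-shift b A)
                  (cong₂ _∷_ (⌊<?⌋-false (<-asym (All.head <M)))
                             (ascentWord-∷ʳ-cong (y ∷ B) (All.map m<n⇒m<1+n <M) (All.map s≤s ≤b))) ⟩
  cappedAscentWord A ++ false ∷ cappedAscentWord (y ∷ B) ∎
  where
  open ≡-Reasoning
  b M : ℕ
  b = length (y ∷ B)
  M = suc (length A + b)
  <M : All (_< M) (y ∷ B)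
  <M = All.map (λ z≤b → s≤s (≤-trans z≤b (m≤n+m b (length A)))) ≤b

join-[]-statistics : ∀ A → IsPermutation A → A ≢ [] →
  adjacentTrues (cappedAscentWord (join A [])) ≡ adjacentTrues (cappedAscentWord A) + 1
  × trueRuns false (cappedAscentWord (join A [])) ≡ trueRuns false (cappedAscentWord A)
join-[]-statistics []       _  A≢[] = ⊥-elim (A≢[] refl)
join-[]-statistics (x ∷ xs) A↭ _
  rewrite cappedAscentWord-join-[] (x ∷ xs) | ascentWord-∷ʳ-max x xs (All.map (s≤s ∘ proj₂) (isPerm-bounded A↭))
  = adjacentTrues-∷ʳ-true (ascentWord (x ∷ xs)) , trueRuns-∷ʳ-true false (ascentWord (x ∷ xs))

join-∷-statistics : ∀ A B → IsPermutation B → B ≢ [] →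
  adjacentTrues (cappedAscentWord (join A B))
    ≡ adjacentTrues (cappedAscentWord A) + adjacentTrues (cappedAscentWord B)
  × trueRuns false (cappedAscentWord (join A B))
    ≡ trueRuns false (cappedAscentWord A) + trueRuns false (cappedAscentWord B)
join-∷-statistics A []      _  B≢[] = ⊥-elim (B≢[] refl)
join-∷-statistics A (y ∷ B) B↭ _    rewrite cappedAscentWord-join-∷ A y B (All.map proj₂ (isPerm-bounded B↭))
  = adjacentTrues-++-false (cappedAscentWord A) _ , trueRuns-++-false false (cappedAscentWord A) _

-- The bijection

mutual
  φ : PTree → List ℕ
  φ (node ts) = joinChildren [] ts

  joinChildren : List ℕ → List PTree → List ℕ
  joinChildren σ []       = σ
  joinChildren σ (t ∷ ts) = joinChildren (join σ (φ t)) ts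

joinChildren-∷ʳ : ∀ σ ts t → joinChildren σ (ts ∷ʳ t) ≡ join (joinChildren σ ts) (φ t)
joinChildren-∷ʳ σ []       t = refl
joinChildren-∷ʳ σ (s ∷ ts) t = joinChildren-∷ʳ (join σ (φ s)) ts t

φ-∷ʳ : ∀ ts t → φ (node (ts ∷ʳ t)) ≡ join (φ (node ts)) (φ t)
φ-∷ʳ = joinChildren-∷ʳ []

PTree-ind-∷ʳ : (P : PTree → Set) → P (node []) → (∀ ts t → P (node ts) → P t → P (node (ts ∷ʳ t))) → ∀ T → P T
PTree-ind-∷ʳ P P-leaf P-∷ʳ (node ts) = go [] P-leaf ts
  where
  go : ∀ ss → P (node ss) → ∀ ts → P (node (ss ++ ts))
  go ss P-ss []       = subst (P ∘ node) (sym (++-identityʳ ss)) P-ss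
  go ss P-ss (t ∷ ts) =
    subst (P ∘ node) (++-assoc ss [ t ] ts) (go (ss ∷ʳ t) (P-∷ʳ ss t P-ss (PTree-ind-∷ʳ P P-leaf P-∷ʳ t)) ts)

edgesL-∷ʳ : ∀ ts t → edgesL (ts ∷ʳ t) ≡ suc (edgesL ts + edges t)
edgesL-∷ʳ []       t = cong suc (+-identityʳ (edges t))
edgesL-∷ʳ (s ∷ ts) t = cong suc (begin
  edges s + edgesL (ts ∷ʳ t)            ≡⟨ cong (edges s +_) (edgesL-∷ʳ ts t) ⟩
  edges s + suc (edgesL ts + edges t)   ≡⟨ +-suc (edges s) _ ⟩
  suc (edges s + (edgesL ts + edges t)) ≡⟨ cong suc (+-assoc (edges s) _ _) ⟨
  suc (edges s + edgesL ts + edges t)   ∎)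
  where open ≡-Reasoning

length-φ : ∀ T → length (φ T) ≡ edges T
length-φ = PTree-ind-∷ʳ (λ T → length (φ T) ≡ edges T) refl λ ts t ih-ts ih-t → begin
  length (φ (node (ts ∷ʳ t)))            ≡⟨ cong length (φ-∷ʳ ts t) ⟩
  length (join (φ (node ts)) (φ t))      ≡⟨ length-join (φ (node ts)) (φ t) ⟩
  suc (length (φ (node ts)) + length (φ t)) ≡⟨ cong suc (cong₂ _+_ ih-ts ih-t) ⟩
  suc (edgesL ts + edges t)              ≡⟨ edgesL-∷ʳ ts t ⟨
  edgesL (ts ∷ʳ t)                       ∎
  where open ≡-Reasoning

φ-node-∷-≢[] : ∀ s ts → φ (node (s ∷ ts)) ≢ []
φ-node-∷-≢[] s ts φ≡[] with () ← trans (sym (cong length φ≡[])) (length-φ (node (s ∷ ts)))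

φ-isPermutation : ∀ T → IsPermutation (φ T)
φ-isPermutation = PTree-ind-∷ʳ (IsPermutation ∘ φ) ↭-refl λ ts t ih-ts ih-t →
  subst IsPermutation (sym (φ-∷ʳ ts t)) (join-isPermutation ih-ts ih-t)

φ-avoids132ᴸ : ∀ T → Avoids132ᴸ (φ T)
φ-avoids132ᴸ = PTree-ind-∷ʳ (Avoids132ᴸ ∘ φ) [] λ ts t ih-ts ih-t →
  subst Avoids132ᴸ (sym (φ-∷ʳ ts t))
    (join-avoids132ᴸ (φ-isPermutation (node ts)) (φ-isPermutation t) ih-ts ih-t)

φ-injective : ∀ T U → φ T ≡ φ U → T ≡ U
φ-injective = PTree-ind-∷ʳ (λ T → ∀ U → φ T ≡ φ U → T ≡ U) leaf step
  where
  leaf : ∀ U → [] ≡ φ U → node [] ≡ U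
  leaf (node us) eq with reverseView us
  ... | []          = refl
  ... | vs ∶ _ ∶ʳ u = ⊥-elim (join-≢[] _ _ (sym (trans eq (φ-∷ʳ vs u))))
  step : ∀ ts t → (∀ U → φ (node ts) ≡ φ U → node ts ≡ U) → (∀ U → φ t ≡ φ U → t ≡ U) →
    ∀ U → φ (node (ts ∷ʳ t)) ≡ φ U → node (ts ∷ʳ t) ≡ U
  step ts t ih-ts ih-t (node us) eq with reverseView us
  ... | []          = ⊥-elim (join-≢[] _ _ (trans (sym (φ-∷ʳ ts t)) eq))
  ... | vs ∶ _ ∶ʳ u
    with φts≡ , φt≡ ← join-injective (φ-isPermutation (node ts)) (φ-isPermutation (node vs))
                        (trans (sym (φ-∷ʳ ts t)) (trans eq (φ-∷ʳ vs u)))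
    with refl ← ih-ts (node vs) φts≡ | refl ← ih-t u φt≡ = refl

φ-surjective : ∀ π → IsPermutation π → Avoids132ᴸ π → ∃ λ T → φ T ≡ π
φ-surjective π = go π (<-wellFounded (length π))
  where
  go : ∀ π → Acc _<_ (length π) → IsPermutation π → Avoids132ᴸ π → ∃ λ T → φ T ≡ π
  go []       _        _  _  = node [] , refl
  go (x ∷ xs) (acc rs) π↭ av
    with A , B , A↭ , avA , B↭ , avB , join≡π ← join-surjective (x ∷ xs) π↭ av
    with A<π , B<π ← join-longer A B
    with node ts , φ≡A ← go A (rs (subst (length A <_) (cong length join≡π) A<π)) A↭ avA
       | t , φ≡B ← go B (rs (subst (length B <_) (cong length join≡π) B<π)) B↭ avB
    = node (ts ∷ʳ t) , trans (φ-∷ʳ ts t) (trans (cong₂ join φ≡A φ≡B) join≡π)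

-- Young and old leaves

countLeaves-∷ʳ : ∀ ts t → countLeaves (ts ∷ʳ t) ≡ countLeaves ts + isLeaf t
countLeaves-∷ʳ []       t = +-identityʳ (isLeaf t)
countLeaves-∷ʳ (s ∷ ts) t = trans (cong (isLeaf s +_) (countLeaves-∷ʳ ts t)) (sym (+-assoc (isLeaf s) _ _))

youngLeavesL-∷ʳ : ∀ ts t → youngLeavesL (ts ∷ʳ t) ≡ youngLeavesL ts + youngLeaves t
youngLeavesL-∷ʳ []       t = +-identityʳ (youngLeaves t)
youngLeavesL-∷ʳ (s ∷ ts) t =
  trans (cong (youngLeaves s +_) (youngLeavesL-∷ʳ ts t)) (sym (+-assoc (youngLeaves s) _ _))

oldLeavesL-∷ʳ : ∀ ts t → oldLeavesL (ts ∷ʳ t) ≡ oldLeavesL ts + oldLeaves t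
oldLeavesL-∷ʳ []       t = +-identityʳ (oldLeaves t)
oldLeavesL-∷ʳ (s ∷ ts) t = trans (cong (oldLeaves s +_) (oldLeavesL-∷ʳ ts t)) (sym (+-assoc (oldLeaves s) _ _))

youngLeaves-∷∷ʳ : ∀ s ts t →
  youngLeaves (node (s ∷ ts ∷ʳ t)) ≡ youngLeaves (node (s ∷ ts)) + isLeaf t + youngLeaves t
youngLeaves-∷∷ʳ s ts t = begin
  countLeaves (ts ∷ʳ t) + (youngLeaves s + youngLeavesL (ts ∷ʳ t))
    ≡⟨ cong₂ (λ c y → c + (youngLeaves s + y)) (countLeaves-∷ʳ ts t) (youngLeavesL-∷ʳ ts t) ⟩
  (countLeaves ts + isLeaf t) + (youngLeaves s + (youngLeavesL ts + youngLeaves t))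
    ≡⟨ rearrange (countLeaves ts) (isLeaf t) (youngLeaves s) (youngLeavesL ts) (youngLeaves t) ⟩
  countLeaves ts + (youngLeaves s + youngLeavesL ts) + isLeaf t + youngLeaves t ∎
  where
  open ≡-Reasoning
  rearrange : ∀ c i y₀ y e → (c + i) + (y₀ + (y + e)) ≡ c + (y₀ + y) + i + e
  rearrange = solve-∀

oldLeaves-∷∷ʳ : ∀ s ts t → oldLeaves (node (s ∷ ts ∷ʳ t)) ≡ oldLeaves (node (s ∷ ts)) + oldLeaves t
oldLeaves-∷∷ʳ s ts t = begin
  isLeaf s + (oldLeaves s + oldLeavesL (ts ∷ʳ t))
    ≡⟨ cong (λ o → isLeaf s + (oldLeaves s + o)) (oldLeavesL-∷ʳ ts t) ⟩
  isLeaf s + (oldLeaves s + (oldLeavesL ts + oldLeaves t))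
    ≡⟨ rearrange (isLeaf s) (oldLeaves s) (oldLeavesL ts) (oldLeaves t) ⟩
  isLeaf s + (oldLeaves s + oldLeavesL ts) + oldLeaves t ∎
  where
  open ≡-Reasoning
  rearrange : ∀ i o₀ o e → i + (o₀ + (o + e)) ≡ i + (o₀ + o) + e
  rearrange = solve-∀

youngLeaves-∷ʳ-node : ∀ ts d ds →
  youngLeaves (node (ts ∷ʳ node (d ∷ ds))) ≡ youngLeaves (node ts) + youngLeaves (node (d ∷ ds))
youngLeaves-∷ʳ-node []       d ds = +-identityʳ _
youngLeaves-∷ʳ-node (s ∷ ts) d ds = trans (youngLeaves-∷∷ʳ s ts (node (d ∷ ds)))
  (cong (_+ youngLeaves (node (d ∷ ds))) (+-identityʳ (youngLeaves (node (s ∷ ts)))))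

oldLeaves-∷ʳ-node : ∀ ts d ds →
  oldLeaves (node (ts ∷ʳ node (d ∷ ds))) ≡ oldLeaves (node ts) + oldLeaves (node (d ∷ ds))
oldLeaves-∷ʳ-node []       d ds = +-identityʳ _
oldLeaves-∷ʳ-node (s ∷ ts) d ds = oldLeaves-∷∷ʳ s ts (node (d ∷ ds))

LeafStatistics : PTree → Set
LeafStatistics T = youngLeaves T ≡ adjacentTrues (cappedAscentWord (φ T))
                 × oldLeaves T ≡ trueRuns false (cappedAscentWord (φ T))

φ-leafStatistics : ∀ T → LeafStatistics T
φ-leafStatistics = PTree-ind-∷ʳ LeafStatistics (refl , refl) step
  where
  step : ∀ ts t → LeafStatistics (node ts) → LeafStatistics t → LeafStatistics (node (ts ∷ʳ t))
  step []       (node [])       _              _            = refl , refl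
  step (s ∷ ts) (node [])       (young , old)  _
    rewrite φ-∷ʳ (s ∷ ts) (node [])
    with adj , runs ← join-[]-statistics (φ (node (s ∷ ts))) (φ-isPermutation (node (s ∷ ts)))
                                         (φ-node-∷-≢[] s ts)
    = trans (youngLeaves-∷∷ʳ s ts (node [])) (trans (+-identityʳ _) (trans (cong (_+ 1) young) (sym adj)))
    , trans (oldLeaves-∷∷ʳ s ts (node [])) (trans (+-identityʳ _) (trans old (sym runs)))
  step ts       (node (d ∷ ds)) (young , old)  (young′ , old′)
    rewrite φ-∷ʳ ts (node (d ∷ ds))
    with adj , runs ← join-∷-statistics (φ (node ts)) (φ (node (d ∷ ds))) (φ-isPermutation (node (d ∷ ds)))
                                        (φ-node-∷-≢[] d ds)
    = trans (youngLeaves-∷ʳ-node ts d ds) (trans (cong₂ _+_ young young′) (sym adj))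
    , trans (oldLeaves-∷ʳ-node ts d ds) (trans (cong₂ _+_ old old′) (sym runs))

φ-statistics : ∀ T → youngLeaves T ≡ doubleAscents (φ T ∷ʳ suc (edges T))
                   × oldLeaves T ≡ ascendingRuns (φ T ∷ʳ suc (edges T))
φ-statistics T with young , old ← φ-leafStatistics T rewrite length-φ T
  = trans young (sym (doubleAscents-ascentWord (φ T ∷ʳ suc (edges T))))
  , trans old (sym (ascRunsFrom-ascentWord false (φ T ∷ʳ suc (edges T))))

mainTheorem8 : (n : ℕ) → 1 ≤ n →
    Σ (PTree → List ℕ) λ φ →
      ((T : PTree) → edges T ≡ n → IsPerm n (φ T) × Avoids132 (φ T))
      × ((T U : PTree) → edges T ≡ n → edges U ≡ n → φ T ≡ φ U → T ≡ U)
      × ((π : List ℕ) → IsPerm n π → Avoids132 π →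
           ∃ λ T → edges T ≡ n × φ T ≡ π)
      × ((T : PTree) → edges T ≡ n →
           (youngLeaves T ≡ doubleAscents (φ T ++ [ suc n ]))
           × (oldLeaves T ≡ ascendingRuns (φ T ++ [ suc n ])))
-- The bijection also holds for n = 0 (one-vertex tree, empty word).
mainTheorem8 n _ = φ , isPerm-avoids , (λ T U _ _ → φ-injective T U) , surjective , statistics
  where
  isPerm-avoids : ∀ T → edges T ≡ n → IsPerm n (φ T) × Avoids132 (φ T)
  isPerm-avoids T refl = subst (λ k → IsPerm k (φ T)) (length-φ T) (φ-isPermutation T)
                       , avoids132ᴸ⇒avoids132 (φ-avoids132ᴸ T)
  surjective : ∀ π → IsPerm n π → Avoids132 π → ∃ λ T → edges T ≡ n × φ T ≡ π
  surjective π π↭ av with T , φ≡π ← φ-surjective π (subst (λ k → IsPerm k π) (sym (isPerm-length π↭)) π↭)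
                                                   (avoids132⇒avoids132ᴸ π av)
    = T , trans (sym (length-φ T)) (trans (cong length φ≡π) (isPerm-length π↭)) , φ≡π
  statistics : ∀ T → edges T ≡ n → youngLeaves T ≡ doubleAscents (φ T ∷ʳ suc n)
                                   × oldLeaves T ≡ ascendingRuns (φ T ∷ʳ suc n)
  statistics T refl = φ-statistics T
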